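{- For every set $\mathcal F$ of LTLf formulae and all LTLf formulae $\varphi,\psi$: $\mathcal F\cup\{\varphi\}\vdash\psi$ if and only if $\mathcal F\vdash\Box\varphi\Rightarrow\psi$.
   Context: Fix a set $\mathrm{Var}$ of propositional variables. LTLf formulae are generated by $\varphi,\psi ::= v \mid \bot \mid \varphi\Rightarrow\psi \mid \mathsf{X}\varphi \mid \varphi\,\mathcal{W}\,\psi$ with $v\in\mathrm{Var}$. Abbreviations: $\neg\varphi := \varphi\Rightarrow\bot$; $\top:=\neg\bot$; $\varphi\vee\psi := \neg\varphi\Rightarrow\psi$; $\varphi\wedge\psi := \neg(\neg\varphi\vee\neg\psi)$; $\varphi\Leftrightarrow\psi := (\varphi\Rightarrow\psi)\wedge(\psi\Rightarrow\varphi)$; $\mathsf{end} := \neg\mathsf{X}\top$; $\bullet\varphi := \neg\mathsf{X}\neg\varphi$; $\Box\varphi := \varphi\,\mathcal{W}\,\bot$; $\Diamond\varphi := \neg\Box\neg\varphi$. Proof system: derivability is closed under propositional reasoning (all instances of propositional tautologies; modus ponens) together with: (WkNextDistr) $\bullet(\varphi\Rightarrow\psi)\Leftrightarrow(\bullet\varphi\Rightarrow\bullet\psi)$; (EndNextContra) $\mathsf{end}\Rightarrow\neg\mathsf{X}\varphi$; (Finite) $\Diamond\mathsf{end}$; (WkUntilUnroll) $\varphi\,\mathcal W\,\psi\Leftrightarrow\psi\vee(\varphi\wedge\bullet(\varphi\,\mathcal W\,\psi))$; (WkNextStep) from $\varphi$ infer $\bullet\varphi$; (Induction) from $\varphi\Rightarrow\psi$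 and $\varphi\Rightarrow\bullet\varphi$ infer $\varphi\Rightarrow\Box\psi$. For a set $\mathcal F$ of formulae, $\mathcal F\vdash\varphi$ means $\varphi$ is derivable in this system with every member of $\mathcal F$ added as an extra axiom. -}

module Defs where

open import Data.Bool using (Bool; true; false; _∨_; not)
open import Data.Sum using (_⊎_)
open import Relation.Binary.PropositionalEquality using (_≡_)

data Formula (Var : Set) : Set where
  var  : Var → Formula Var
  ⊥'   : Formula Var
  _⇒_  : Formula Var → Formula Var → Formula Var
  X    : Formula Var → Formula Var
  _W_  : Formula Var → Formula Var → Formula Var

infixr 5 _⇒_

module _ {Var : Set} where

  ¬' : Formula Var → Formula Var
  ¬' φ = φ ⇒ ⊥'

  ⊤' : Formula Var
  ⊤' = ¬' ⊥'

  _∨'_ : Formula Var → Formula Var → Formula Var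
  φ ∨' ψ = ¬' φ ⇒ ψ

  _∧'_ : Formula Var → Formula Var → Formula Var
  φ ∧' ψ = ¬' (¬' φ ∨' ¬' ψ)

  _⇔'_ : Formula Var → Formula Var → Formula Var
  φ ⇔' ψ = (φ ⇒ ψ) ∧' (ψ ⇒ φ)

  end : Formula Var
  end = ¬' (X ⊤')

  ● : Formula Var → Formula Var
  ● φ = ¬' (X (¬' φ))

  □ : Formula Var → Formula Var
  □ φ = φ W ⊥'

  ◇ : Formula Var → Formula Var
  ◇ φ = ¬' (□ (¬' φ))

  -- Propositional evaluation: ⊥ and ⇒ are the connectives; every other
  -- formula (variables, X φ, φ W ψ) is treated as a propositional atom.
  peval : (Formula Var → Bool) → Formula Var → Bool
  peval v ⊥'      = false
  peval v (φ ⇒ ψ) = not (peval v φ) ∨ peval v ψ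
  peval v φ@(var _)  = v φ
  peval v φ@(X _)    = v φ
  peval v φ@(_ W _)  = v φ

  -- instances of propositional tautologies
  Tautology : Formula Var → Set
  Tautology φ = (v : Formula Var → Bool) → peval v φ ≡ true

  FSet : Set₁
  FSet = Formula Var → Set

  _∪｛_｝ : FSet → Formula Var → FSet
  (F ∪｛ φ ｝) χ = F χ ⊎ χ ≡ φ

  data _⊢_ (F : FSet) : Formula Var → Set where
    hyp           : ∀ {φ} → F φ → F ⊢ φ
    taut          : ∀ {φ} → Tautology φ → F ⊢ φ
    mp            : ∀ {φ ψ} → F ⊢ (φ ⇒ ψ) → F ⊢ φ → F ⊢ ψ
    wkNextDistr   : ∀ {φ ψ} → F ⊢ (● (φ ⇒ ψ) ⇔' (● φ ⇒ ● ψ))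
    endNextContra : ∀ {φ} → F ⊢ (end ⇒ ¬' (X φ))
    finite        : F ⊢ ◇ end
    wkUntilUnroll : ∀ {φ ψ} → F ⊢ ((φ W ψ) ⇔' (ψ ∨' (φ ∧' ● (φ W ψ))))
    wkNextStep    : ∀ {φ} → F ⊢ φ → F ⊢ ● φ
    induction     : ∀ {φ ψ} → F ⊢ (φ ⇒ ψ) → F ⊢ (φ ⇒ ● φ) → F ⊢ (φ ⇒ □ ψ)

  infix 3 _⊢_

-- From φ as an axiom WkNextStep yields ●φ, but φ ⇒ ●φ is not derivable, so a
-- deduction theorem cannot discharge φ itself; it discharges □φ instead. Every
-- rule survives relativisation to □φ because □φ implies φ and propagates
-- itself forward (□φ ⇒ ●□φ); for Induction the invariant α is strengthened to
-- □φ ∧ α. Conversely φ yields □φ by necessitation, a special case of Induction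
-- with the invariant ⊤.
module Submission where

open import Data.Bool using (Bool; true; false; T; _∧_; _∨_; not)
open import Data.Bool.Properties using (T-∧; T-≡)
open import Data.Empty using (⊥)
open import Data.Fin using (Fin; zero; suc)
open import Data.Nat using (zero; suc)
open import Data.Product using (_×_; _,_; proj₁; proj₂)
open import Data.Sum using (inj₁; inj₂)
open import Data.Unit using (⊤)
open import Data.Vec using (Vec; []; _∷_; lookup; map)
open import Data.Vec.Properties using (lookup-map)
open import Function.Bundles using (_⇔_; mk⇔; Equivalence)
open import Relation.Binary.PropositionalEquality using (_≡_; refl; sym; trans; cong₂)

open import Defs

infixl 30 _[_]

_[_] : {A B : Set} → Formula A → (A → Formula B) → Formula B
var a   [ ρ ] = ρ a
⊥'      [ ρ ] = ⊥'
(p ⇒ q) [ ρ ] = p [ ρ ] ⇒ q [ ρ ]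
X p     [ ρ ] = X (p [ ρ ])
(p W q) [ ρ ] = p [ ρ ] W q [ ρ ]

Propositional : {A : Set} → Formula A → Set
Propositional (var _) = ⊤
Propositional ⊥'      = ⊤
Propositional (p ⇒ q) = Propositional p × Propositional q
Propositional (X _)   = ⊥
Propositional (_ W _) = ⊥

-- Only meaningful on propositional formulae; the X and W clauses are junk.
holds : ∀ {n} → Vec Bool n → Formula (Fin n) → Bool
holds w (var i) = lookup w i
holds w ⊥'      = false
holds w (p ⇒ q) = not (holds w p) ∨ holds w q
holds w (X _)   = false
holds w (_ W _) = false

every : ∀ {n} → (Vec Bool n → Bool) → Bool
every {zero}  f = f []
every {suc n} f = every (λ w → f (true ∷ w)) ∧ every (λ w → f (false ∷ w))

every-sound : ∀ {n} (f : Vec Bool n → Bool) → T (every f) → (w : Vec Bool n) → T (f w)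
every-sound f h []          = h
every-sound f h (true ∷ w)  = every-sound _ (proj₁ (Equivalence.to T-∧ h)) w
every-sound f h (false ∷ w) = every-sound _ (proj₂ (Equivalence.to T-∧ h)) w

IsTautology : ∀ {n} → Formula (Fin n) → Set
IsTautology p = Propositional p × T (every (λ w → holds w p))

module _ {Var : Set} where

  peval-instance : ∀ {n} (v : Formula Var → Bool) (ρ : Vec (Formula Var) n)
                   (p : Formula (Fin n)) → Propositional p →
                   peval v (p [ lookup ρ ]) ≡ holds (map (peval v) ρ) p
  peval-instance v ρ (var i) _ = sym (lookup-map i (peval v) ρ)
  peval-instance v ρ ⊥'      _ = refl
  peval-instance v ρ (p ⇒ q) (prop-p , prop-q) =
    cong₂ (λ a b → not a ∨ b) (peval-instance v ρ p prop-p) (peval-instance v ρ q prop-q)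

  instance-tautology : ∀ {n} (p : Formula (Fin n)) (ρ : Vec (Formula Var) n) →
                       IsTautology p → Tautology (p [ lookup ρ ])
  instance-tautology p ρ (prop , valid) v =
    trans (peval-instance v ρ p prop)
          (Equivalence.to T-≡ (every-sound _ valid (map (peval v) ρ)))

x₀ : ∀ {n} → Formula (Fin (suc n))
x₀ = var zero

x₁ : ∀ {n} → Formula (Fin (suc (suc n)))
x₁ = var (suc zero)

x₂ : ∀ {n} → Formula (Fin (suc (suc (suc n))))
x₂ = var (suc (suc zero))

⊢-mono : ∀ {Var} {F G : FSet {Var}} {ψ} → (∀ {χ} → F χ → G χ) → F ⊢ ψ → G ⊢ ψ
⊢-mono F⊆G (hyp h)         = hyp (F⊆G h)
⊢-mono F⊆G (taut t)        = taut t
⊢-mono F⊆G (mp p q)        = mp (⊢-mono F⊆G p) (⊢-mono F⊆G q)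
⊢-mono F⊆G wkNextDistr     = wkNextDistr
⊢-mono F⊆G endNextContra   = endNextContra
⊢-mono F⊆G finite          = finite
⊢-mono F⊆G wkUntilUnroll   = wkUntilUnroll
⊢-mono F⊆G (wkNextStep p)  = wkNextStep (⊢-mono F⊆G p)
⊢-mono F⊆G (induction p q) = induction (⊢-mono F⊆G p) (⊢-mono F⊆G q)

module _ {Var : Set} {F : FSet {Var}} where

  by-truth-table : ∀ {n} (p : Formula (Fin n)) (ρ : Vec (Formula Var) n) →
                   IsTautology p → F ⊢ p [ lookup ρ ]
  by-truth-table p ρ t = taut (instance-tautology p ρ t)

  ⊤-intro : F ⊢ ⊤'
  ⊤-intro = by-truth-table ⊤' [] _

  ⇒-const : ∀ {a b} → F ⊢ a → F ⊢ b ⇒ a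
  ⇒-const {a} {b} = mp (by-truth-table (x₀ ⇒ x₁ ⇒ x₀) (a ∷ b ∷ []) _)

  ⇒-ap : ∀ {a b c} → F ⊢ c ⇒ a ⇒ b → F ⊢ c ⇒ a → F ⊢ c ⇒ b
  ⇒-ap {a} {b} {c} p =
    mp (mp (by-truth-table ((x₂ ⇒ x₀ ⇒ x₁) ⇒ (x₂ ⇒ x₀) ⇒ x₂ ⇒ x₁) (a ∷ b ∷ c ∷ []) _) p)

  ⇒-trans : ∀ {a b c} → F ⊢ a ⇒ b → F ⊢ b ⇒ c → F ⊢ a ⇒ c
  ⇒-trans p q = ⇒-ap (⇒-const q) p

  ⇔-to : ∀ {a b} → F ⊢ a ⇔' b → F ⊢ a ⇒ b
  ⇔-to {a} {b} = mp (by-truth-table ((x₀ ⇔' x₁) ⇒ x₀ ⇒ x₁) (a ∷ b ∷ []) _)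

  ∧-pair : ∀ {a b} → F ⊢ a ⇒ b ⇒ a ∧' b
  ∧-pair {a} {b} = by-truth-table (x₀ ⇒ x₁ ⇒ x₀ ∧' x₁) (a ∷ b ∷ []) _

  ∧-fst : ∀ {a b} → F ⊢ a ∧' b ⇒ a
  ∧-fst {a} {b} = by-truth-table (x₀ ∧' x₁ ⇒ x₀) (a ∷ b ∷ []) _

  ∧-snd : ∀ {a b} → F ⊢ a ∧' b ⇒ b
  ∧-snd {a} {b} = by-truth-table (x₀ ∧' x₁ ⇒ x₁) (a ∷ b ∷ []) _

  ∧-curry : ∀ {a b c} → F ⊢ a ∧' b ⇒ c → F ⊢ a ⇒ b ⇒ c
  ∧-curry {a} {b} {c} =
    mp (by-truth-table ((x₀ ∧' x₁ ⇒ x₂) ⇒ x₀ ⇒ x₁ ⇒ x₂) (a ∷ b ∷ c ∷ []) _)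

  ∧-uncurry : ∀ {a b c} → F ⊢ a ⇒ b ⇒ c → F ⊢ a ∧' b ⇒ c
  ∧-uncurry {a} {b} {c} =
    mp (by-truth-table ((x₀ ⇒ x₁ ⇒ x₂) ⇒ x₀ ∧' x₁ ⇒ x₂) (a ∷ b ∷ c ∷ []) _)

  ●-map : ∀ {a b} → F ⊢ a ⇒ b → F ⊢ ● a ⇒ ● b
  ●-map p = mp (⇔-to wkNextDistr) (wkNextStep p)

  ●-∧ : ∀ {a b} → F ⊢ ● a ⇒ ● b ⇒ ● (a ∧' b)
  ●-∧ = ⇒-trans (●-map ∧-pair) (⇔-to wkNextDistr)

  □-unfold : ∀ {a} → F ⊢ □ a ⇒ a ∧' ● (□ a)
  □-unfold {a} =
    ⇒-trans (⇔-to wkUntilUnroll) (by-truth-table (⊥' ∨' x₀ ⇒ x₀) (a ∧' ● (□ a) ∷ []) _)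

  □-head : ∀ {a} → F ⊢ □ a ⇒ a
  □-head = ⇒-trans □-unfold ∧-fst

  □-step : ∀ {a} → F ⊢ □ a ⇒ ● (□ a)
  □-step = ⇒-trans □-unfold ∧-snd

  □-intro : ∀ {a} → F ⊢ a → F ⊢ □ a
  □-intro p = mp (induction (⇒-const p) (⇒-const (wkNextStep ⊤-intro))) ⊤-intro

  module _ {φ : Formula Var} where

    ●-under-□ : ∀ {χ} → F ⊢ □ φ ⇒ χ → F ⊢ □ φ ⇒ ● χ
    ●-under-□ p = ⇒-trans □-step (●-map p)

    induction-under-□ : ∀ {α β} → F ⊢ □ φ ⇒ α ⇒ β → F ⊢ □ φ ⇒ α ⇒ ● α →
                        F ⊢ □ φ ⇒ α ⇒ □ β
    induction-under-□ {α} p q = ∧-curry (induction (∧-uncurry p) invariant-step)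
      where
      invariant-step : F ⊢ □ φ ∧' α ⇒ ● (□ φ ∧' α)
      invariant-step = ⇒-ap (⇒-ap (⇒-const ●-∧) (⇒-trans ∧-fst □-step)) (∧-uncurry q)

deduction : ∀ {Var} {F : FSet {Var}} {φ χ} → F ∪｛ φ ｝ ⊢ χ → F ⊢ □ φ ⇒ χ
deduction (hyp (inj₁ h))     = ⇒-const (hyp h)
deduction (hyp (inj₂ refl))  = □-head
deduction (taut t)           = ⇒-const (taut t)
deduction (mp p q)           = ⇒-ap (deduction p) (deduction q)
deduction wkNextDistr        = ⇒-const wkNextDistr
deduction endNextContra      = ⇒-const endNextContra
deduction finite             = ⇒-const finite
deduction wkUntilUnroll      = ⇒-const wkUntilUnroll
deduction (wkNextStep p)     = ●-under-□ (deduction p)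
deduction (induction p q)    = induction-under-□ (deduction p) (deduction q)

theorem4p3 : {Var : Set} (F : Formula Var → Set) (φ ψ : Formula Var) →
    ((F ∪｛ φ ｝) ⊢ ψ) ⇔ (F ⊢ (□ φ ⇒ ψ))
theorem4p3 F φ ψ = mk⇔ deduction undo-deduction
  where
  undo-deduction : F ⊢ □ φ ⇒ ψ → F ∪｛ φ ｝ ⊢ ψ
  undo-deduction p = mp (⊢-mono inj₁ p) (□-intro (hyp (inj₂ refl)))
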